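{- Let $w(n)$ be the least integer $m\ge0$ such that $a(m)\ge n$. If $n\ge 2$ and $F_k\le n<F_{k+1}$, then $w(n)=F_k+1$.
   Context: Fibonacci numbers: $F_0=0$, $F_1=1$, $F_n=F_{n-1}+F_{n-2}$. The sequence $(a(n))_{n\geq 0}$ (OEIS A105774) is defined by $a(n)=n$ for $n\le 1$, and $a(n)=F_{j+1}-a(n-F_j)$ if $F_j<n\le F_{j+1}$ with $j\ge 2$. -}

module Defs where

open import Data.Nat using (ℕ; zero; suc; _+_; _∸_; _≤_; _<_; _≤?_; _<?_)
open import Data.Bool using (Bool; true; false; if_then_else_)
open import Relation.Nullary.Decidable using (⌊_⌋)

F : ℕ → ℕ
F zero = 0
F (suc zero) = 1
F (suc (suc n)) = F (suc n) + F n

-- findJ n j fuel : the least j' ≥ j (searching at most fuel steps) with n ≤ F (j'+1).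
-- For n ≥ 2, starting at j = 2 with enough fuel, this is the unique j ≥ 2 with
-- F j < n ≤ F (j+1).
findJ : ℕ → ℕ → ℕ → ℕ
findJ n j zero = j
findJ n j (suc fuel) = if ⌊ n ≤? F (suc j) ⌋ then j else findJ n (suc j) fuel

-- the index j with F j < n ≤ F (j+1), j ≥ 2 (for n ≥ 2); fuel n suffices since F (n+1) ≥ n
jOf : ℕ → ℕ
jOf n = findJ n 2 n

-- a with explicit fuel (fuel ≥ n suffices because n - F j < n when n ≥ 2)
aFuel : ℕ → ℕ → ℕ
aFuel zero n = n
aFuel (suc fuel) zero = 0
aFuel (suc fuel) (suc zero) = 1
aFuel (suc fuel) (suc (suc m)) =
  let n = suc (suc m) ; j = jOf n in F (suc j) ∸ aFuel fuel (n ∸ F j)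

-- OEIS A105774: a(n) = n for n ≤ 1, a(n) = F(j+1) - a(n - F j) if F j < n ≤ F (j+1), j ≥ 2
a : ℕ → ℕ
a n = aFuel n n

IsW : ℕ → ℕ → Set
IsW n m = (n ≤ a m) × (∀ m' → m' < m → a m' < n)
  where open import Data.Product using (_×_)

module Submission where

-- On the block F j < m ≤ F (j+1) (j ≥ 2) we have m − F j ≤ F (j−1), and by induction
-- 1 ≤ a (m − F j) ≤ F (j−1); hence a m = F (j+1) − a (m − F j) lies in [F j, F (j+1)).
-- So every m ≤ F k has a m < F k ≤ n (or a m ≤ 1 < n when m ≤ 1), while
-- a (F k + 1) = F (k+1) − a 1 = F (k+1) − 1 ≥ n.

open import Defs
open import Data.Nat using (ℕ; zero; suc; pred; _+_; _∸_; _≤_; _<_; z≤n; s≤s; _≤?_; _<?_)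
open import Data.Nat.Properties
open import Data.Nat.Induction using (<-rec)
open import Data.Product using (_×_; _,_; proj₁; proj₂)
open import Data.Empty using (⊥-elim)
open import Relation.Nullary using (yes; no)
open import Relation.Binary.PropositionalEquality using (_≡_; refl; sym; cong; subst)
open Relation.Binary.PropositionalEquality.≡-Reasoning

F-suc-pos : ∀ n → 1 ≤ F (suc n)
F-suc-pos zero    = s≤s z≤n
F-suc-pos (suc n) = ≤-trans (F-suc-pos n) (m≤m+n _ _)

F-≤-suc : ∀ n → F n ≤ F (suc n)
F-≤-suc zero          = z≤n
F-≤-suc (suc zero)    = s≤s z≤n
F-≤-suc (suc (suc n)) = m≤m+n _ _

F-mono : ∀ {i j} → i ≤ j → F i ≤ F j
F-mono {i} i≤j with m≤n⇒∃[o]m+o≡n i≤j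
... | o , refl = F-≤-+ o
  where
  F-≤-+ : ∀ o → F i ≤ F (i + o)
  F-≤-+ zero    rewrite +-identityʳ i = ≤-refl
  F-≤-+ (suc o) rewrite +-suc i o     = ≤-trans (F-≤-+ o) (F-≤-suc (i + o))

F-cancel-< : ∀ {i j} → F i < F j → i < j
F-cancel-< {i} {j} Fi<Fj with i <? j
... | yes i<j = i<j
... | no  i≮j = ⊥-elim (<⇒≱ Fi<Fj (F-mono (≮⇒≥ i≮j)))

n≤F[1+n] : ∀ n → n ≤ F (suc n)
n≤F[1+n] zero          = z≤n
n≤F[1+n] (suc zero)    = s≤s z≤n
n≤F[1+n] (suc (suc n)) =
  subst (_≤ F (suc (suc (suc n)))) (+-comm (suc n) 1)
    (+-mono-≤ (n≤F[1+n] (suc n)) (F-suc-pos n))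

F[1+j]∸F[j] : ∀ {j} → 1 ≤ j → F (suc j) ∸ F j ≡ F (pred j)
F[1+j]∸F[j] {suc j} _ = m+n∸m≡n (F (suc j)) (F j)

findJ-≥ : ∀ n j fuel → j ≤ findJ n j fuel
findJ-≥ n j zero = ≤-refl
findJ-≥ n j (suc fuel) with n ≤? F (suc j)
... | yes _ = ≤-refl
... | no  _ = ≤-trans (n≤1+n j) (findJ-≥ n (suc j) fuel)

findJ-brackets : ∀ n j fuel → F j < n → n ≤ F (suc (j + fuel)) →
                 F (findJ n j fuel) < n × n ≤ F (suc (findJ n j fuel))
findJ-brackets n j zero Fj<n n≤F rewrite +-identityʳ j = Fj<n , n≤F
findJ-brackets n j (suc fuel) Fj<n n≤F with n ≤? F (suc j)
... | yes n≤F[1+j] = Fj<n , n≤F[1+j]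
... | no  n≰F[1+j] =
  findJ-brackets n (suc j) fuel (≰⇒> n≰F[1+j]) (subst (λ i → n ≤ F (suc i)) (+-suc j fuel) n≤F)

2≤jOf : ∀ n → 2 ≤ jOf n
2≤jOf n = findJ-≥ n 2 n

1≤F[jOf] : ∀ n → 1 ≤ F (jOf n)
1≤F[jOf] n = F-mono (2≤jOf n)

jOf-brackets : ∀ {n} → 2 ≤ n → F (jOf n) < n × n ≤ F (suc (jOf n))
jOf-brackets {n} 2≤n =
  findJ-brackets n 2 n 2≤n (≤-trans (n≤F[1+n] n) (F-mono (s≤s (m≤n+m n 2))))

jOf-< : ∀ {n i} → 2 ≤ n → n ≤ F i → jOf n < i
jOf-< 2≤n n≤Fi = F-cancel-< (<-≤-trans (proj₁ (jOf-brackets 2≤n)) n≤Fi)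

jOf-unique : ∀ {n j} → 2 ≤ n → F j < n → n ≤ F (suc j) → jOf n ≡ j
jOf-unique 2≤n Fj<n n≤F[1+j] =
  ≤-antisym (≤-pred (jOf-< 2≤n n≤F[1+j]))
            (≤-pred (F-cancel-< (<-≤-trans Fj<n (proj₂ (jOf-brackets 2≤n)))))

suc∸pos≤ : ∀ {m d} → 1 ≤ d → suc m ∸ d ≤ m
suc∸pos≤ {m} {suc d} _ = m∸n≤m m d

aFuel-irrelevant : ∀ f g n → n ≤ f → n ≤ g → aFuel f n ≡ aFuel g n
aFuel-irrelevant zero    zero    zero _ _ = refl
aFuel-irrelevant zero    (suc g) zero _ _ = refl
aFuel-irrelevant (suc f) zero    zero _ _ = refl
aFuel-irrelevant (suc f) (suc g) zero _ _ = refl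
aFuel-irrelevant (suc f) (suc g) (suc zero) _ _ = refl
aFuel-irrelevant (suc f) (suc g) n@(suc (suc m)) (s≤s m<f) (s≤s m<g) =
  cong (F (suc (jOf n)) ∸_)
    (aFuel-irrelevant f g (n ∸ F (jOf n)) (≤-trans r≤1+m m<f) (≤-trans r≤1+m m<g))
  where
  r≤1+m : n ∸ F (jOf n) ≤ suc m
  r≤1+m = suc∸pos≤ (1≤F[jOf] n)

a-unfold : ∀ {m} → 2 ≤ m → a m ≡ F (suc (jOf m)) ∸ a (m ∸ F (jOf m))
a-unfold {m@(suc (suc m₀))} (s≤s (s≤s z≤n)) =
  cong (F (suc (jOf m)) ∸_)
    (aFuel-irrelevant (suc m₀) r r (suc∸pos≤ (1≤F[jOf] m)) ≤-refl)
  where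
  r : ℕ
  r = m ∸ F (jOf m)

∸-bounds : ∀ {b c x} → b ≤ c → 1 ≤ x → x ≤ c ∸ b → b ≤ c ∸ x × c ∸ x < c
∸-bounds {b} {c} {x} b≤c 1≤x x≤c∸b =
  m+n≤o⇒m≤o∸n b (subst (_≤ c) (+-comm x b) (m≤o∸n⇒m+n≤o x b≤c x≤c∸b)) ,
  ∸-monoʳ-< 1≤x (≤-trans x≤c∸b (m∸n≤m c b))

InWindow : ℕ → Set
InWindow m = F (jOf m) ≤ a m × a m < F (suc (jOf m))

InWindow⇒<F : ∀ {m i} → 2 ≤ m → m ≤ F i → InWindow m → a m < F i
InWindow⇒<F {i = i} 2≤m m≤Fi (_ , a<F[1+j]) = <-≤-trans a<F[1+j] (F-mono (jOf-< {i = i} 2≤m m≤Fi))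

-- The next two lemmas take the window property as a hypothesis so that they can
-- serve the induction proving it.
a-pos : ∀ {r} → 1 ≤ r → (2 ≤ r → InWindow r) → 1 ≤ a r
a-pos {suc zero}    _ _      = s≤s z≤n
a-pos {suc (suc r)} _ window = ≤-trans (1≤F[jOf] (suc (suc r))) (proj₁ (window (s≤s (s≤s z≤n))))

a-≤F : ∀ {r i} → r ≤ F i → (2 ≤ r → InWindow r) → a r ≤ F i
a-≤F {zero}        _    _      = z≤n
a-≤F {suc zero}    1≤Fi _      = 1≤Fi
a-≤F {suc (suc r)} {i} r≤Fi window = <⇒≤ (InWindow⇒<F {i = i} 2≤r r≤Fi (window 2≤r))
  where
  2≤r : 2 ≤ suc (suc r)
  2≤r = s≤s (s≤s z≤n)

a-inWindow : ∀ m → 2 ≤ m → InWindow m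
a-inWindow = <-rec (λ m → 2 ≤ m → InWindow m) step
  where
  step : ∀ m → (∀ {r} → r < m → 2 ≤ r → InWindow r) → 2 ≤ m → InWindow m
  step m ih 2≤m =
    subst (λ y → F j ≤ y × y < F (suc j)) (sym (a-unfold 2≤m))
      (∸-bounds (F-≤-suc j) (a-pos 1≤r (ih r<m)) a[r]≤gap)
    where
    j : ℕ
    j = jOf m
    r : ℕ
    r = m ∸ F j
    1≤j : 1 ≤ j
    1≤j = ≤-trans (s≤s z≤n) (2≤jOf m)
    Fj<m : F j < m
    Fj<m = proj₁ (jOf-brackets 2≤m)
    1≤r : 1 ≤ r
    1≤r = m<n⇒0<n∸m Fj<m
    r<m : r < m
    r<m = ∸-monoʳ-< (1≤F[jOf] m) (<⇒≤ Fj<m)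
    r≤F[j-1] : r ≤ F (pred j)
    r≤F[j-1] = subst (r ≤_) (F[1+j]∸F[j] 1≤j)
                 (∸-monoˡ-≤ (F j) (proj₂ (jOf-brackets 2≤m)))
    a[r]≤gap : a r ≤ F (suc j) ∸ F j
    a[r]≤gap = subst (a r ≤_) (sym (F[1+j]∸F[j] 1≤j)) (a-≤F {i = pred j} r≤F[j-1] (ih r<m))

a<F : ∀ {m i} → 2 ≤ m → m ≤ F i → a m < F i
a<F {m} {i} 2≤m m≤Fi = InWindow⇒<F {i = i} 2≤m m≤Fi (a-inWindow m 2≤m)

a[F+1] : ∀ {k} → 1 ≤ F k → F k < F (suc k) → a (F k + 1) ≡ F (suc k) ∸ 1
a[F+1] {k} 1≤Fk Fk<F[1+k] = begin
  a (F k + 1)                                  ≡⟨ a-unfold 2≤m ⟩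
  F (suc (jOf m)) ∸ a (m ∸ F (jOf m))          ≡⟨ cong (λ j → F (suc j) ∸ a (m ∸ F j)) jOf-m ⟩
  F (suc k) ∸ a (m ∸ F k)                      ≡⟨ cong (λ r → F (suc k) ∸ a r) (m+n∸m≡n (F k) 1) ⟩
  F (suc k) ∸ 1                                ∎
  where
  m : ℕ
  m = F k + 1
  2≤m : 2 ≤ m
  2≤m = +-monoˡ-≤ 1 1≤Fk
  jOf-m : jOf m ≡ k
  jOf-m = jOf-unique 2≤m (m<m+n (F k) (s≤s z≤n))
            (subst (_≤ F (suc k)) (+-comm 1 (F k)) Fk<F[1+k])

a<n-below : ∀ {m n k} → 2 ≤ n → F k ≤ n → m ≤ F k → a m < n
a<n-below {zero}                2≤n _    _    = <-trans (s≤s z≤n) 2≤n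
a<n-below {suc zero}            2≤n _    _    = 2≤n
a<n-below {suc (suc m)} {k = k} _   Fk≤n m≤Fk = <-≤-trans (a<F {i = k} (s≤s (s≤s z≤n)) m≤Fk) Fk≤n

proposition20 : (n k : ℕ) → 2 ≤ n → F k ≤ n → n < F (suc k) → IsW n (F k + 1)
proposition20 n zero    2≤n _    n<1 = ⊥-elim (<⇒≱ n<1 (≤-trans (s≤s z≤n) 2≤n))
proposition20 n (suc k) 2≤n Fk≤n n<F[1+k] =
  n≤a[m] , λ m' m'<m → a<n-below {k = suc k} 2≤n Fk≤n (m'≤Fk m'<m)
  where
  n≤a[m] : n ≤ a (F (suc k) + 1)
  n≤a[m] = subst (n ≤_) (sym (a[F+1] {suc k} (F-suc-pos k) (≤-<-trans Fk≤n n<F[1+k])))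
             (m+n≤o⇒m≤o∸n n (subst (_≤ F (suc (suc k))) (+-comm 1 n) n<F[1+k]))
  m'≤Fk : ∀ {m'} → m' < F (suc k) + 1 → m' ≤ F (suc k)
  m'≤Fk {m'} m'<m = m<1+n⇒m≤n (subst (m' <_) (+-comm (F (suc k)) 1) m'<m)
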